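{- Let $F_c$ be a family of sets, $X=\bigcup F_c$, $w:X\to\mathbb{N}$, and let $L$ be any list without repetitions whose set of entries is $\{A\subseteq X : s(A)<0\}$, where $s(A)=2w(A)-w(X)$. If $\mathrm{ssn}_L(L,\emptyset,\mathrm{cl}(F_c))=\mathrm{false}$, then for every union closed extension $F'$ of $F_c$ we have $\sum_{A\in F'}s(A)\ge 0$.
   Context: All sets and families are finite. $w(A)=\sum_{a\in A}w(a)$; the share of a set is $s(A)=2w(A)-w(X)$ and the share of a family $G$ is $s(G)=\sum_{A\in G}s(A)$ (integers). $\mathrm{cl}(F_c)$ is the smallest union closed family containing $F_c$. A family is union closed for $G_c$ if it is closed under pairwise unions and $A\cup B$ lies in it whenever $A$ is in it and $B\in G_c$. Union closed extensions of $F_c$: families $F'\subseteq\mathcal{P}(\bigcup F_c)$ union closed for $F_c$. For a family $G_c$, a set $h$ and a family $G$, $\mathrm{ic}_{G_c}(h,G)=G\cup\{h\}\cup\{h\cup B: B\in G\}\cup\{h\cup B : B\in G_c\}$. The boolean function $\mathrm{ssn}_L(L,F_t,G_c)$ (with $w,X$ fixed) is defined by recursion on the list: $\mathrm{ssn}_L([\,],F_t,G_c)=(s(F_t)<0)$; and for a list $h\#t$ with head $h$ and tail $t$: if $s(F_t)+\sum_{A\in\mathrm{set}(h\#t)}s(A)\ge 0$ then false; else if $\mathrm{ssn}_L(t,F_t,G_c)$ then true; else if $h\in F_t$ then false; else $\mathrm{ssn}_L(t,\mathrm{ic}_{G_c}(h,F_t),G_c)$. -}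

module Defs where

open import Data.Bool using (Bool; true; false; _∧_; _∨_; if_then_else_)
open import Data.Nat using (ℕ; zero; suc)
open import Data.Integer using (ℤ; +_; _-_; _+_; _*_; _<_; _≤?_)
open import Data.Fin using (Fin)
open import Data.Fin.Subset using (Subset; _∪_; ⊥; _⊆_)
open import Data.Vec using (Vec; []; _∷_)
open import Data.Vec.Properties using (≡-dec)
import Data.Bool as B
open import Data.List using (List; []; _∷_; map; filter; foldr; allFin; zipWith)
open import Data.Bool.ListAction using (any)
open import Data.Nat.ListAction using (sum)
open import Relation.Nullary using (Dec; yes; no; does)
open import Relation.Binary.PropositionalEquality using (_≡_)
open import Relation.Binary.Definitions using (DecidableEquality)

-- The ground universe is Fin n; sets are subsets of Fin n.
-- A family of sets is a (decidable) subset of the power set, given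
-- by its characteristic function.
Family : ℕ → Set
Family n = Subset n → Bool

_≟S_ : ∀ {n} → DecidableEquality (Subset n)
_≟S_ = ≡-dec B._≟_

allSubsets : (n : ℕ) → List (Subset n)
allSubsets zero = [] ∷ []
allSubsets (suc n) = map (true ∷_) (allSubsets n) Data.List.++ map (false ∷_) (allSubsets n)

members : ∀ {n} → Family n → List (Subset n)
members {n} F = filter (λ A → F A B.≟ true) (allSubsets n)

emptyFam : ∀ {n} → Family n
emptyFam _ = false

bigUnion : ∀ {n} → Family n → Subset n
bigUnion F = foldr _∪_ ⊥ (members F)

wt : ∀ {n} → (Fin n → ℕ) → Subset n → ℕ
wt w A = sum (zipWith (λ i b → if b then w i else 0) (allFin _) (Data.Vec.toList A))

share : ∀ {n} → (Fin n → ℕ) → Subset n → Subset n → ℤ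
share w X A = (+ 2) * (+ wt w A) - (+ wt w X)

sumℤ : List ℤ → ℤ
sumℤ = foldr _+_ (+ 0)

shareFam : ∀ {n} → (Fin n → ℕ) → Subset n → Family n → ℤ
shareFam w X G = sumℤ (map (share w X) (members G))

inList : ∀ {n} → Subset n → List (Subset n) → Bool
inList A l = any (λ B → does (A ≟S B)) l

setOf : ∀ {n} → List (Subset n) → Family n
setOf l A = inList A l

ic : ∀ {n} → Family n → Subset n → Family n → Family n
ic {n} Gc h G C =
  G C ∨ does (C ≟S h)
      ∨ any (λ B → G B ∧ does ((h ∪ B) ≟S C)) (allSubsets n)
      ∨ any (λ B → Gc B ∧ does ((h ∪ B) ≟S C)) (allSubsets n)

neg? : ℤ → Bool
neg? z = B.not (does (+ 0 ≤? z))

ssnL : ∀ {n} → (Fin n → ℕ) → Subset n → List (Subset n) → Family n → Family n → Bool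
ssnL w X [] Ft Gc = neg? (shareFam w X Ft)
ssnL w X (h ∷ t) Ft Gc =
  if does (+ 0 ≤? (shareFam w X Ft + shareFam w X (setOf (h ∷ t))))
  then false
  else (if ssnL w X t Ft Gc
        then true
        else (if Ft h then false else ssnL w X t (ic Gc h Ft) Gc))

UnionClosed : ∀ {n} → Family n → Set
UnionClosed F = ∀ A B → F A ≡ true → F B ≡ true → F (A ∪ B) ≡ true

UnionClosedFor : ∀ {n} → Family n → Family n → Set
UnionClosedFor Gc F =
  UnionClosed F × (∀ A B → F A ≡ true → Gc B ≡ true → F (A ∪ B) ≡ true)
  where open import Data.Product using (_×_)

_⊆F_ : ∀ {n} → Family n → Family n → Set
F ⊆F G = ∀ A → F A ≡ true → G A ≡ true

IsClosure : ∀ {n} → Family n → Family n → Set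
IsClosure Fc Gc =
  (Fc ⊆F Gc) × UnionClosed Gc × (∀ G → Fc ⊆F G → UnionClosed G → Gc ⊆F G)
  where open import Data.Product using (_×_)

UCExtension : ∀ {n} → Family n → Family n → Set
UCExtension Fc F' =
  (∀ A → F' A ≡ true → A ⊆ bigUnion Fc) × UnionClosedFor Fc F'
  where open import Data.Product using (_×_)

module Submission where

-- Fix w and X = ⋃Fc, write s for the share and s(G) for the share of a
-- family.  For a union closed extension F' of Fc the recursion of ssn_L
-- maintains the following invariant for its current family Ft and list L:
--   Ft ⊆ F',  every entry of L has negative share,  and every member of F'
--   with negative share that is not in Ft is an entry of L.
-- Under the invariant s(Ft) + s(set L) ≤ s(F'): members of Ft ∪ set L
-- missing from F' are excluded, sets counted twice are negative, and the
-- members of F' that are not counted are non-negative.  So whenever ssn_L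
-- answers false because s(Ft) + s(set L) ≥ 0, we get s(F') ≥ 0.  In the
-- remaining cases the invariant passes to the recursive call that returned
-- false: the head h is either irrelevant (h ∈ Ft or h ∉ F') or it lies in F',
-- and then ic(h, Ft) ⊆ F' because F' is union closed for cl(Fc).

open import Defs
open import Data.Bool using (Bool; true; false; T; _∧_; if_then_else_)
import Data.Bool as Bool
open import Data.Bool.ListAction using (any)
open import Data.Bool.Properties using (T-≡; T-∧; T-∨)
open import Data.Empty using (⊥-elim)
open import Data.Fin using (Fin)
open import Data.Fin.Subset using (Subset; _⊆_; _∪_)
open import Data.Fin.Subset.Properties using (∪-assoc; anySubset?)
open import Data.Integer using (ℤ; +_; _+_; _≤_; _<_; _≤?_; _<?_)
import Data.Integer.Properties as ℤ
open import Algebra.Properties.CommutativeSemigroup ℤ.+-commutativeSemigroup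
  using (interchange)
open import Data.List using (List; []; _∷_; map; filter)
open import Data.List.Membership.Propositional using (_∈_)
open import Data.List.Properties using (filter-none)
open import Data.List.Relation.Unary.All using (universal)
open import Data.List.Relation.Unary.Any as Any using (here; there)
open import Data.List.Relation.Unary.Any.Properties using (any⁺; any⁻)
open import Data.List.Relation.Unary.Unique.Propositional using (Unique)
open import Data.Nat using (ℕ)
open import Data.Product using (_×_; _,_; proj₁; proj₂; ∃)
open import Data.Sum using (_⊎_; inj₁; inj₂)
open import Function.Bundles using (_⇔_; Equivalence; mk⇔)
open import Relation.Binary.PropositionalEquality
  using (_≡_; refl; sym; trans; cong; subst)
open import Relation.Nullary using (Dec; yes; no; does; ¬_)
open import Relation.Nullary.Decidable using (_×-dec_)

open Equivalence using (to; from)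

true≢false : ¬ true ≡ false
true≢false ()

T-does : ∀ {P : Set} (d : Dec P) → T (does d) ⇔ P
T-does (yes p) = mk⇔ (λ _ → p) (λ _ → _)
T-does (no ¬p) = mk⇔ (λ ()) ¬p

setOf-∈ : ∀ {n} (A : Subset n) (l : List (Subset n)) → setOf l A ≡ true ⇔ A ∈ l
setOf-∈ A l = mk⇔
  (λ e → Any.map (λ {B} → to (T-does (A ≟S B))) (any⁻ _ l (from T-≡ e)))
  (λ m → to T-≡ (any⁺ _ (Any.map (λ {B} → from (T-does (A ≟S B))) m)))

∈-tail : ∀ {A : Set} {x h : A} {t : List A} → x ∈ h ∷ t → ¬ x ≡ h → x ∈ t
∈-tail (here x≡h) x≢h = ⊥-elim (x≢h x≡h)
∈-tail (there x∈t) _ = x∈t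

any-witness : ∀ {A : Set} {P : A → Set} (P? : ∀ x → Dec (P x)) (G : A → Bool) (xs : List A)
  → T (any (λ x → G x ∧ does (P? x)) xs) → ∃ λ x → T (G x) × P x
any-witness P? G xs found with Any.satisfied (any⁻ _ xs found)
... | x , both with to T-∧ both
...   | Gx , Px = x , Gx , to (T-does (P? x)) Px

select : Bool → ℤ → ℤ
select b z = if b then z else + 0

sum-filter : ∀ {A : Set} (P : A → Bool) (f : A → ℤ) (xs : List A)
  → sumℤ (map f (filter (λ x → P x Bool.≟ true) xs)) ≡ sumℤ (map (λ x → select (P x) (f x)) xs)
sum-filter P f [] = refl
sum-filter P f (x ∷ xs) with P x
... | true = cong (λ rest → f x + rest) (sum-filter P f xs)
... | false = trans (sum-filter P f xs) (sym (ℤ.+-identityˡ _))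

sum-mono : ∀ {A : Set} (f g h : A → ℤ) → (∀ x → f x + g x ≤ h x)
  → ∀ xs → sumℤ (map f xs) + sumℤ (map g xs) ≤ sumℤ (map h xs)
sum-mono f g h pointwise [] = ℤ.≤-refl
sum-mono f g h pointwise (x ∷ xs) = begin
  (f x + sumℤ (map f xs)) + (g x + sumℤ (map g xs))
    ≡⟨ interchange (f x) (sumℤ (map f xs)) (g x) (sumℤ (map g xs)) ⟩
  (f x + g x) + (sumℤ (map f xs) + sumℤ (map g xs))
    ≤⟨ ℤ.+-mono-≤ (pointwise x) (sum-mono f g h pointwise xs) ⟩
  h x + sumℤ (map h xs) ∎
  where open ℤ.≤-Reasoning

-- The pointwise form of s(Ft) + s(N) ≤ s(F'): membership in Ft (a) implies
-- membership in F' (c), members of N (b) are negative, and a negative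
-- member of F' outside Ft belongs to N.
select-bound : ∀ (a b c : Bool) (z : ℤ) → (a ≡ true → c ≡ true) → (b ≡ true → z < + 0)
  → (c ≡ true → a ≡ false → z < + 0 → b ≡ true)
  → select a z + select b z ≤ select c z
select-bound true  true  true  z _ neg _ =
  ℤ.≤-trans (ℤ.+-monoʳ-≤ z (ℤ.<⇒≤ (neg refl))) (ℤ.≤-reflexive (ℤ.+-identityʳ z))
select-bound true  false true  z _ _ _ = ℤ.≤-reflexive (ℤ.+-identityʳ z)
select-bound true  b     false z within _ _ with () ← within refl
select-bound false true  true  z _ _ _ = ℤ.≤-reflexive (ℤ.+-identityˡ z)
select-bound false true  false z _ neg _ =
  ℤ.≤-trans (ℤ.≤-reflexive (ℤ.+-identityˡ z)) (ℤ.<⇒≤ (neg refl))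
select-bound false false true  z _ _ covers with z <? + 0
... | yes z<0 with () ← covers refl refl z<0
... | no z≮0 = ℤ.≮⇒≥ z≮0
select-bound false false false z _ _ _ = ℤ.≤-refl

module Shares {n : ℕ} (w : Fin n → ℕ) (X : Subset n) where

  s : Subset n → ℤ
  s = share w X

  shareFam-select : ∀ F → shareFam w X F ≡ sumℤ (map (λ A → select (F A) (s A)) (allSubsets n))
  shareFam-select F = sum-filter F s (allSubsets n)

  shareFam-empty : shareFam w X emptyFam ≡ + 0
  shareFam-empty = cong (λ members → sumℤ (map s members))
    (filter-none (λ A → emptyFam A Bool.≟ true) (universal (λ _ ()) (allSubsets n)))

  share-bound : (Ft N F' : Family n) → Ft ⊆F F' → (∀ A → N A ≡ true → s A < + 0)
    → (∀ A → F' A ≡ true → Ft A ≡ false → s A < + 0 → N A ≡ true)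
    → shareFam w X Ft + shareFam w X N ≤ shareFam w X F'
  share-bound Ft N F' within negative covers
    rewrite shareFam-select Ft | shareFam-select N | shareFam-select F' =
    sum-mono _ _ _
      (λ A → select-bound (Ft A) (N A) (F' A) (s A) (within A) (negative A) (covers A))
      (allSubsets n)

Absorbs : ∀ {n} → Family n → Subset n → Set
Absorbs F' B = ∀ A → F' A ≡ true → F' (A ∪ B) ≡ true

absorbs? : ∀ {n} (F' : Family n) (B : Subset n) → Dec (Absorbs F' B)
absorbs? F' B with anySubset? (λ A → (F' A Bool.≟ true) ×-dec (F' (A ∪ B) Bool.≟ false))
... | yes (A , A∈F' , A∪B∉F') = no λ absorbs → true≢false (trans (sym (absorbs A A∈F')) A∪B∉F')
... | no noCounterexample = yes absorbs
  where absorbs : Absorbs F' B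
        absorbs A A∈F' with F' (A ∪ B) in eq
        ... | true = refl
        ... | false with () ← noCounterexample (A , A∈F' , eq)

-- The sets absorbed by F' form a union closed family containing Fc, so
-- they contain cl(Fc).
closure-lift : ∀ {n} {Fc Gc F' : Family n} → IsClosure Fc Gc
  → UnionClosedFor Fc F' → UnionClosedFor Gc F'
closure-lift {Fc = Fc} {Gc} {F'} (_ , _ , least) (ucF' , ucFc) =
  ucF' , λ A B A∈F' B∈Gc → absorbed⇒ (least absorbed Fc⊆absorbed absorbedUC B B∈Gc) A A∈F'
  where
  absorbed : Family _
  absorbed B = does (absorbs? F' B)

  absorbed⇒ : ∀ {B} → absorbed B ≡ true → Absorbs F' B
  absorbed⇒ {B} e = to (T-does (absorbs? F' B)) (from T-≡ e)

  ⇒absorbed : ∀ {B} → Absorbs F' B → absorbed B ≡ true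
  ⇒absorbed {B} abs = to T-≡ (from (T-does (absorbs? F' B)) abs)

  Fc⊆absorbed : Fc ⊆F absorbed
  Fc⊆absorbed B B∈Fc = ⇒absorbed λ A A∈F' → ucFc A B A∈F' B∈Fc

  absorbedUC : UnionClosed absorbed
  absorbedUC B₁ B₂ e₁ e₂ = ⇒absorbed λ A A∈F' →
    subst (λ C → F' C ≡ true) (∪-assoc A B₁ B₂)
      (absorbed⇒ e₂ (A ∪ B₁) (absorbed⇒ e₁ A A∈F'))

module Soundness {n : ℕ} (w : Fin n → ℕ) (X : Subset n) (Gc F' : Family n)
                 (ucF' : UnionClosedFor Gc F') where
  open Shares w X

  ic-cases : ∀ {h Ft C} → T (ic Gc h Ft C)
    → T (Ft C) ⊎ C ≡ h ⊎ (∃ λ B → T (Ft B) × h ∪ B ≡ C) ⊎ (∃ λ B → T (Gc B) × h ∪ B ≡ C)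
  ic-cases {h} {Ft} {C} member with to T-∨ member
  ... | inj₁ C∈Ft = inj₁ C∈Ft
  ... | inj₂ other with to T-∨ other
  ...   | inj₁ C≟h = inj₂ (inj₁ (to (T-does (C ≟S h)) C≟h))
  ...   | inj₂ union with to T-∨ union
  ...     | inj₁ viaFt = inj₂ (inj₂ (inj₁ (any-witness (λ B → (h ∪ B) ≟S C) Ft (allSubsets n) viaFt)))
  ...     | inj₂ viaGc = inj₂ (inj₂ (inj₂ (any-witness (λ B → (h ∪ B) ≟S C) Gc (allSubsets n) viaGc)))

  ic-within : ∀ {h Ft} → F' h ≡ true → Ft ⊆F F' → ic Gc h Ft ⊆F F'
  ic-within {h} {Ft} h∈F' Ft⊆F' C C∈ic with ic-cases {h} {Ft} (from T-≡ C∈ic)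
  ... | inj₁ C∈Ft = Ft⊆F' C (to T-≡ C∈Ft)
  ... | inj₂ (inj₁ refl) = h∈F'
  ... | inj₂ (inj₂ (inj₁ (B , B∈Ft , refl))) = proj₁ ucF' h B h∈F' (Ft⊆F' B (to T-≡ B∈Ft))
  ... | inj₂ (inj₂ (inj₂ (B , B∈Gc , refl))) = proj₂ ucF' h B h∈F' (to T-≡ B∈Gc)

  ic-outside : ∀ {h Ft C} → ic Gc h Ft C ≡ false → Ft C ≡ false × ¬ C ≡ h
  ic-outside {h} {Ft} {C} C∉ic with Ft C | C ≟S h
  ... | false | no C≢h = refl , C≢h

  record Invariant (Ft : Family n) (L : List (Subset n)) : Set where
    field
      within   : Ft ⊆F F'
      negative : ∀ A → A ∈ L → s A < + 0
      covers   : ∀ A → F' A ≡ true → Ft A ≡ false → s A < + 0 → A ∈ L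
  open Invariant

  invariant-bound : ∀ {Ft L} → Invariant Ft L
    → shareFam w X Ft + shareFam w X (setOf L) ≤ shareFam w X F'
  invariant-bound {Ft} {L} inv = share-bound Ft (setOf L) F' (within inv)
    (λ A A∈L → negative inv A (to (setOf-∈ A L) A∈L))
    (λ A A∈F' A∉Ft A<0 → from (setOf-∈ A L) (covers inv A A∈F' A∉Ft A<0))

  drop-head : ∀ {Ft h t} → Invariant Ft (h ∷ t)
    → (∀ A → F' A ≡ true → Ft A ≡ false → ¬ A ≡ h) → Invariant Ft t
  drop-head inv not-head = record
    { within   = within inv
    ; negative = λ A A∈t → negative inv A (there A∈t)
    ; covers   = λ A A∈F' A∉Ft A<0 →
        ∈-tail (covers inv A A∈F' A∉Ft A<0) (not-head A A∈F' A∉Ft) }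

  absorb-head : ∀ {Ft h t} → Invariant Ft (h ∷ t) → F' h ≡ true → Invariant (ic Gc h Ft) t
  absorb-head {Ft} {h} inv h∈F' = record
    { within   = ic-within h∈F' (within inv)
    ; negative = λ A A∈t → negative inv A (there A∈t)
    ; covers   = λ A A∈F' A∉ic A<0 → let (A∉Ft , A≢h) = ic-outside {h} {Ft} A∉ic in
        ∈-tail (covers inv A A∈F' A∉Ft A<0) A≢h }

  ssn-cons-false : ∀ {h t Ft} → ssnL w X (h ∷ t) Ft Gc ≡ false
    → (+ 0 ≤ shareFam w X Ft + shareFam w X (setOf (h ∷ t)))
      ⊎ (ssnL w X t Ft Gc ≡ false × (Ft h ≡ true ⊎ ssnL w X t (ic Gc h Ft) Gc ≡ false))
  ssn-cons-false {h} {t} {Ft} answer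
    with + 0 ≤? shareFam w X Ft + shareFam w X (setOf (h ∷ t))
  ... | yes nonneg = inj₁ nonneg
  ... | no _ with ssnL w X t Ft Gc | Ft h
  ...   | false | true = inj₂ (refl , inj₁ refl)
  ...   | false | false = inj₂ (refl , inj₂ answer)

  sound : ∀ L Ft → ssnL w X L Ft Gc ≡ false → Invariant Ft L → + 0 ≤ shareFam w X F'
  sound [] Ft answer inv with + 0 ≤? shareFam w X Ft
  ... | yes nonneg = begin
    + 0                                                ≤⟨ nonneg ⟩
    shareFam w X Ft                                    ≡⟨ sym (ℤ.+-identityʳ _) ⟩
    shareFam w X Ft + + 0                              ≡⟨ cong (λ z → shareFam w X Ft + z) (sym shareFam-empty) ⟩
    shareFam w X Ft + shareFam w X (setOf [])          ≤⟨ invariant-bound inv ⟩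
    shareFam w X F'                                    ∎
    where open ℤ.≤-Reasoning
  sound (h ∷ t) Ft answer inv with ssn-cons-false {h} {t} {Ft} answer
  ... | inj₁ nonneg = ℤ.≤-trans nonneg (invariant-bound inv)
  ... | inj₂ (rest , inj₁ h∈Ft) =
    sound t Ft rest (drop-head inv λ { _ _ h∉Ft refl → true≢false (trans (sym h∈Ft) h∉Ft) })
  ... | inj₂ (rest , inj₂ restIc) with F' h in F'h
  ...   | true = sound t (ic Gc h Ft) restIc (absorb-head inv F'h)
  ...   | false =
    sound t Ft rest (drop-head inv λ { _ A∈F' _ refl → true≢false (trans (sym A∈F') F'h) })

-- Main theorem: the initial state (∅, L) satisfies the invariant because L
-- lists exactly the negative subsets of X and F' ⊆ P(X); moreover F' is
-- union closed for cl(Fc).  Uniqueness of the entries of L is not needed.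
theorem2 : (n : ℕ) (Fc : Family n) (w : Fin n → ℕ) (L : List (Subset n))
    → Unique L
    → (∀ A → (A ∈ L) ⇔ (A ⊆ bigUnion Fc × share w (bigUnion Fc) A < + 0))
    → (Gc : Family n) → IsClosure Fc Gc
    → ssnL w (bigUnion Fc) L emptyFam Gc ≡ false
    → (F' : Family n) → UCExtension Fc F'
    → + 0 ≤ shareFam w (bigUnion Fc) F'
theorem2 n Fc w L _ L-negative Gc closure answer F' (F'⊆PX , ucF') =
  sound L emptyFam answer initial
  where
  open Soundness w (bigUnion Fc) Gc F' (closure-lift closure ucF')
  initial : Invariant emptyFam L
  initial = record
    { within   = λ _ ()
    ; negative = λ A A∈L → proj₂ (to (L-negative A) A∈L)
    ; covers   = λ A A∈F' _ A<0 → from (L-negative A) (F'⊆PX A A∈F' , A<0) }
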